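{- Let $G$ be an oriented graph derived from a Burling tree $T$ and let $uv$ be a bottom arc of $G$ with respect to $T$. Let $G'$ be the oriented graph obtained from $G$ by removing the arc $uv$ and adding a new vertex $w$ together with the arcs $uw$ and $wv$. Then $G'$ can be derived from a Burling tree $T'$ in such a way that $uw$ is a bottom arc of $G'$ with respect to $T'$, $wv$ is both a bottom arc and a top arc of $G'$ with respect to $T'$, every top arc of $G$ with respect to $T$ other than $uv$ is a top arc of $G'$ with respect to $T'$, and every bottom arc of $G$ with respect to $T$ other than $uv$ is a bottom arc of $G'$ with respect to $T'$.
   Context: Rooted trees: for a rooted tree $(T,r)$ and $v\neq r$, $p(v)$ is the parent of $v$. A branch is a path $v_1v_2\dots v_k$ of $T$ with $v_i$ the parent of $v_{i+1}$ for all $i$ (it starts at $v_1$); a branch may be empty. A Burling tree is a 4-tuple $(T,r,\ell,c)$ where $T$ is a rooted tree with root $r$; $\ell$ assigns to every non-leaf vertex $v$ one of its children $\ell(v)$, the last-born of $v$; and $c$ is a function on $V(T)$ such that if $v\neq r$ is not a last-born then $c(v)$ is the vertex set of a (possibly empty) branch of $T$ starting at $\ell(p(v))$, while $c(v)=\varnothing$ if $v$ is the root or a last-born. The oriented graph fully derived from the Burling tree has vertex set $V(T)$ and an arc $uv$ iff $v\in c(u)$. An oriented graph $G$ is derived from the Burling tree if it is an induced subgraph of the fully derived oriented graph. For such $G$ and an arc $uv$ of $G$, all out-neighbours of $u$ in $G$ lie on the branch $c(u)$; $uv$ is a top arc with respect to $T$ if $v$ is the out-neighbour of $u$ in $G$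 closest in $T$ to the root, and a bottom arc with respect to $T$ if $v$ is the out-neighbour of $u$ in $G$ furthest in $T$ from the root. -}

module Defs where

open import Data.Nat using (ℕ; zero; suc; _≤_)
open import Data.Fin using (Fin; zero; suc)
open import Data.List using (List; []; _∷_)
open import Data.List.Membership.Propositional using (_∈_)
open import Data.Product using (Σ; ∃; ∃-syntax; _×_; _,_)
open import Data.Sum using (_⊎_)
open import Data.Empty using (⊥)
open import Relation.Nullary using (¬_)
open import Relation.Binary.PropositionalEquality using (_≡_; _≢_)
open import Function.Definitions using (Injective)

iter : {A : Set} → (A → A) → ℕ → A → A
iter f zero    x = x
iter f (suc k) x = f (iter f k x)

-- A finite rooted tree: vertex set Fin m, root r, and a parent map par
-- (with the convention par r ≡ r; p(v) is only meaningful for v ≢ r),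
-- such that every vertex reaches the root by iterating par.
-- (Reaching the root forces acyclicity, so this is exactly a rooted tree.)
record RootedTree : Set where
  field
    m        : ℕ
    r        : Fin m
    par      : Fin m → Fin m
    par-root : par r ≡ r
    reach    : ∀ v → ∃[ k ] (iter par k v ≡ r)

module _ (T : RootedTree) where
  open RootedTree T

  IsParentOf : Fin m → Fin m → Set
  IsParentOf p v = v ≢ r × par v ≡ p

  data IsBranch : List (Fin m) → Set where
    empty  : IsBranch []
    single : ∀ x → IsBranch (x ∷ [])
    step   : ∀ {x y bs} → IsParentOf x y → IsBranch (y ∷ bs) → IsBranch (x ∷ y ∷ bs)

  IsBranchFrom : Fin m → List (Fin m) → Set
  IsBranchFrom x b = IsBranch b × (b ≡ [] ⊎ ∃[ bs ] (b ≡ x ∷ bs))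

  DistRoot : Fin m → ℕ → Set
  DistRoot v d = iter par d v ≡ r × (∀ k → iter par k v ≡ r → d ≤ k)

record BurlingTree : Set where
  field
    tree : RootedTree
  open RootedTree tree public
  field
    ℓ       : Fin m → Fin m
    ℓ-child : ∀ v x → IsParentOf tree v x → IsParentOf tree v (ℓ v)
    c       : Fin m → List (Fin m)
  IsLastBorn : Fin m → Set
  IsLastBorn v = v ≢ r × ℓ (par v) ≡ v
  field
    c-branch : ∀ v → v ≢ r → ¬ IsLastBorn v → IsBranchFrom tree (ℓ (par v)) (c v)
    c-empty  : ∀ v → (v ≡ r ⊎ IsLastBorn v) → c v ≡ []

record OGraph : Set₁ where
  field
    n   : ℕ
    Arc : Fin n → Fin n → Set

module _ (B : BurlingTree) (G : OGraph) where
  open BurlingTree B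
  open OGraph G

  -- G is derived from B via the embedding f: G is (isomorphic via f to)
  -- the induced subgraph of the fully derived graph on the image of f
  DerivedVia : (Fin n → Fin m) → Set
  DerivedVia f = Injective _≡_ _≡_ f × (∀ x y → (Arc x y → f y ∈ c (f x)) × (f y ∈ c (f x) → Arc x y))

  TopArc : (Fin n → Fin m) → Fin n → Fin n → Set
  TopArc f x y = Arc x y × (∀ y' → Arc x y' → ∀ d d' → DistRoot tree (f y) d → DistRoot tree (f y') d' → d ≤ d')

  BottomArc : (Fin n → Fin m) → Fin n → Fin n → Set
  BottomArc f x y = Arc x y × (∀ y' → Arc x y' → ∀ d d' → DistRoot tree (f y) d → DistRoot tree (f y') d' → d' ≤ d)

-- subdivide the arc u v of G: new vertex w = zero, old vertex x becomes suc x
subdivide : (G : OGraph) → Fin (OGraph.n G) → Fin (OGraph.n G) → OGraph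
subdivide G u v = record { n = suc n ; Arc = A }
  where
  open OGraph G
  A : Fin (suc n) → Fin (suc n) → Set
  A zero    zero    = ⊥
  A zero    (suc y) = y ≡ v
  A (suc x) zero    = x ≡ u
  A (suc x) (suc y) = Arc x y × ¬ (x ≡ u × y ≡ v)

{-# OPTIONS --safe #-}
module Submission where

-- Every c(t) is a branch, along which the depth strictly increases, so a bottom (top) arc
-- leaving x is exactly an arc to the out-neighbour of x that comes last (first) on c(f x).
-- Write U = f u, V = f v and a = p(V). The new tree gets two fresh vertices: a vertex z
-- inserted between a and all its children other than U, which becomes the last-born of a
-- (with ℓ(z) = ℓ(a)); and a leaf w, hung below z if p(U) = a and below a otherwise.
-- Then c(U) is cut after V, with w in the place of V (and z prepended if p(U) = a); this
-- loses no arc because uv is a bottom arc, so every other out-neighbour of u precedes V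
-- on c(U), and it makes uw a bottom arc. We set c(w) = V or z V, and every other c(t) is
-- kept, with z inserted before each re-parented vertex. All these lists order the old
-- vertices as before, so top and bottom arcs other than uv survive.

open import Defs
open import Data.Fin using (Fin; zero; suc)
open import Data.Product using (Σ; Σ-syntax; _×_)
open import Relation.Nullary using (¬_)
open import Relation.Binary.PropositionalEquality using (_≡_)

open import Data.Bool using (if_then_else_)
open import Function using (_∘_)
open import Data.Empty using (⊥-elim)
open import Data.Fin.Properties using (_≟_)
open import Data.List using (List; []; _∷_)
open import Data.List.Membership.Propositional using (_∈_; _∉_)
open import Data.List.Relation.Unary.Any using (here; there)
open import Data.Nat using (ℕ; zero; suc; _≤_; _<_; z≤n; s≤s)
open import Data.Nat.Properties using (≤-refl; ≤-reflexive; ≤-antisym; <-irrefl; <⇒≤; <⇒≱; <-trans; n<1+n)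
open import Data.Product using (∃; ∃-syntax; _,_; proj₁; proj₂)
open import Data.Sum using (_⊎_; inj₁; inj₂)
open import Relation.Binary.PropositionalEquality using (_≢_; refl; sym; trans; cong; subst)
open import Relation.Nullary using (Dec; yes; no; does)
open import Relation.Nullary.Decidable using (dec-true; dec-false; ¬?; _×-dec_)

if-does-elim : ∀ {A Q : Set} (P : A → Set) (q? : Dec Q) {x y : A}
             → (Q → P x) → (¬ Q → P y) → P (if does q? then x else y)
if-does-elim P (yes q) px _  = px q
if-does-elim P (no ¬q) _  py = py ¬q

iter-sucʳ : ∀ {A : Set} (g : A → A) k x → iter g (suc k) x ≡ iter g k (g x)
iter-sucʳ g zero    x = refl
iter-sucʳ g (suc k) x = cong g (iter-sucʳ g k x)

module _ {A : Set} where

  data Precedes (x y : A) : List A → Set where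
    now   : ∀ {xs} → y ∈ xs → Precedes x y (x ∷ xs)
    later : ∀ {z xs} → Precedes x y xs → Precedes x y (z ∷ xs)

  Precedes⇒∈ˡ : ∀ {x y xs} → Precedes x y xs → x ∈ xs
  Precedes⇒∈ˡ (now _)   = here refl
  Precedes⇒∈ˡ (later p) = there (Precedes⇒∈ˡ p)

  Precedes⇒∈ʳ : ∀ {x y xs} → Precedes x y xs → y ∈ xs
  Precedes⇒∈ʳ (now y∈xs) = there y∈xs
  Precedes⇒∈ʳ (later p)  = there (Precedes⇒∈ʳ p)

  ∈-trichotomy : ∀ {x y xs} → x ∈ xs → y ∈ xs → x ≡ y ⊎ Precedes x y xs ⊎ Precedes y x xs
  ∈-trichotomy (here refl) (here refl) = inj₁ refl
  ∈-trichotomy (here refl) (there y∈) = inj₂ (inj₁ (now y∈))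
  ∈-trichotomy (there x∈) (here refl) = inj₂ (inj₂ (now x∈))
  ∈-trichotomy (there x∈) (there y∈) with ∈-trichotomy x∈ y∈
  ... | inj₁ x≡y          = inj₁ x≡y
  ... | inj₂ (inj₁ x≺y)   = inj₂ (inj₁ (later x≺y))
  ... | inj₂ (inj₂ y≺x)   = inj₂ (inj₂ (later y≺x))

module Depth (T : RootedTree) where
  open RootedTree T

  DistRoot-unique : ∀ {v d d′} → DistRoot T v d → DistRoot T v d′ → d ≡ d′
  DistRoot-unique (reach-d , least-d) (reach-d′ , least-d′) =
    ≤-antisym (least-d _ reach-d′) (least-d′ _ reach-d)

  DistRoot-child : ∀ {x d} → x ≢ r → DistRoot T (par x) d → DistRoot T x (suc d)
  DistRoot-child {x} {d} x≢r (reach-d , least-d) = trans (iter-sucʳ par d x) reach-d , least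
    where
    least : ∀ k → iter par k x ≡ r → suc d ≤ k
    least zero    x≡r = ⊥-elim (x≢r x≡r)
    least (suc k) eq  = s≤s (least-d k (trans (sym (iter-sucʳ par k x)) eq))

  DistRoot-reached : ∀ k x → iter par k x ≡ r → ∃ (DistRoot T x)
  DistRoot-reached k x eq with x ≟ r
  DistRoot-reached k x eq | yes refl = zero , refl , λ _ _ → z≤n
  DistRoot-reached zero x eq | no x≢r = ⊥-elim (x≢r eq)
  DistRoot-reached (suc k) x eq | no x≢r
    with d , dist ← DistRoot-reached k (par x) (trans (sym (iter-sucʳ par k x)) eq)
    = suc d , DistRoot-child x≢r dist

  depth : ∀ x → ∃ (DistRoot T x)
  depth x = let k , eq = reach x in DistRoot-reached k x eq

  branch-DistRoot< : ∀ {x xs y d d′} → IsBranch T (x ∷ xs) → y ∈ xs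
                   → DistRoot T x d → DistRoot T y d′ → d < d′
  branch-DistRoot< (step (y≢r , refl) _) (here refl) dist-x dist-y
    rewrite DistRoot-unique dist-y (DistRoot-child y≢r dist-x) = ≤-refl
  branch-DistRoot< {d = d} (step (x₂≢r , refl) br) (there y∈) dist-x dist-y =
    <-trans (n<1+n d) (branch-DistRoot< br y∈ (DistRoot-child x₂≢r dist-x) dist-y)

  IsBranch-tail : ∀ {x xs} → IsBranch T (x ∷ xs) → IsBranch T xs
  IsBranch-tail (single _) = empty
  IsBranch-tail (step _ br) = br

  Precedes⇒DistRoot< : ∀ {xs x y d d′} → IsBranch T xs → Precedes x y xs
                     → DistRoot T x d → DistRoot T y d′ → d < d′
  Precedes⇒DistRoot< br (now y∈)  = branch-DistRoot< br y∈
  Precedes⇒DistRoot< br (later p) = Precedes⇒DistRoot< (IsBranch-tail br) p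

  Precedes-irrefl : ∀ {xs x} → IsBranch T xs → ¬ Precedes x x xs
  Precedes-irrefl {x = x} br p = let d , dist = depth x in <-irrefl refl (Precedes⇒DistRoot< br p dist dist)

  Precedes⇒¬siblings : ∀ {xs x y} → IsBranch T xs → Precedes x y xs
                    → x ≢ r → y ≢ r → par x ≢ par y
  Precedes⇒¬siblings {x = x} br p x≢r y≢r px≡py =
    let d , dist = depth (par x)
    in <-irrefl refl (Precedes⇒DistRoot< br p (DistRoot-child x≢r dist)
                                               (DistRoot-child y≢r (subst (λ t → DistRoot T t d) px≡py dist)))

  branch-∌-root : ∀ {x xs y} → IsBranch T (x ∷ xs) → x ≢ r → y ∈ x ∷ xs → y ≢ r
  branch-∌-root br x≢r (here refl) = x≢r
  branch-∌-root (step (x₂≢r , _) br) x≢r (there y∈) = branch-∌-root br x₂≢r y∈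

module _ (B : BurlingTree) where
  open BurlingTree B

  c-IsBranch : ∀ t → IsBranch tree (c t)
  c-IsBranch t with t ≟ r
  ... | yes t≡r = subst (IsBranch tree) (sym (c-empty t (inj₁ t≡r))) empty
  ... | no t≢r with ℓ (par t) ≟ t
  ...   | yes lb = subst (IsBranch tree) (sym (c-empty t (inj₂ (t≢r , lb)))) empty
  ...   | no ¬lb = proj₁ (c-branch t t≢r (λ lb → ¬lb (proj₂ lb)))

module Derived (B : BurlingTree) (G : OGraph) (f : Fin (OGraph.n G) → Fin (BurlingTree.m B))
               (derived : DerivedVia B G f) where
  open BurlingTree B
  open OGraph G
  open Depth tree

  f-injective : ∀ {x y} → f x ≡ f y → x ≡ y
  f-injective = proj₁ derived

  Arc⇒∈c : ∀ {x y} → Arc x y → f y ∈ c (f x)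
  Arc⇒∈c {x} {y} = proj₁ (proj₂ derived x y)

  ∈c⇒Arc : ∀ {x y} → f y ∈ c (f x) → Arc x y
  ∈c⇒Arc {x} {y} = proj₂ (proj₂ derived x y)

  LastOutNeighbour FirstOutNeighbour : Fin n → Fin n → Set
  LastOutNeighbour  x y = Arc x y × (∀ y′ → Arc x y′ → ¬ Precedes (f y) (f y′) (c (f x)))
  FirstOutNeighbour x y = Arc x y × (∀ y′ → Arc x y′ → ¬ Precedes (f y′) (f y) (c (f x)))

  BottomArc⇒Last : ∀ {x y} → BottomArc B G f x y → LastOutNeighbour x y
  BottomArc⇒Last {x} {y} (xy , lowest) = xy , λ y′ xy′ y≺y′ →
    let d , dist = depth (f y) ; d′ , dist′ = depth (f y′)
    in <⇒≱ (Precedes⇒DistRoot< (c-IsBranch B (f x)) y≺y′ dist dist′) (lowest y′ xy′ d d′ dist dist′)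

  TopArc⇒First : ∀ {x y} → TopArc B G f x y → FirstOutNeighbour x y
  TopArc⇒First {x} {y} (xy , highest) = xy , λ y′ xy′ y′≺y →
    let d , dist = depth (f y) ; d′ , dist′ = depth (f y′)
    in <⇒≱ (Precedes⇒DistRoot< (c-IsBranch B (f x)) y′≺y dist′ dist) (highest y′ xy′ d d′ dist dist′)

  Last⇒BottomArc : ∀ {x y} → LastOutNeighbour x y → BottomArc B G f x y
  Last⇒BottomArc {x} {y} (xy , last) = xy , lowest
    where
    lowest : ∀ y′ → Arc x y′ → ∀ d d′ → DistRoot tree (f y) d → DistRoot tree (f y′) d′ → d′ ≤ d
    lowest y′ xy′ d d′ dist dist′ with ∈-trichotomy (Arc⇒∈c xy) (Arc⇒∈c xy′)
    ... | inj₁ fy≡fy′      = ≤-reflexive (DistRoot-unique dist′ (subst (λ t → DistRoot tree t d) fy≡fy′ dist))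
    ... | inj₂ (inj₁ y≺y′) = ⊥-elim (last y′ xy′ y≺y′)
    ... | inj₂ (inj₂ y′≺y) = <⇒≤ (Precedes⇒DistRoot< (c-IsBranch B (f x)) y′≺y dist′ dist)

  First⇒TopArc : ∀ {x y} → FirstOutNeighbour x y → TopArc B G f x y
  First⇒TopArc {x} {y} (xy , first) = xy , highest
    where
    highest : ∀ y′ → Arc x y′ → ∀ d d′ → DistRoot tree (f y) d → DistRoot tree (f y′) d′ → d ≤ d′
    highest y′ xy′ d d′ dist dist′ with ∈-trichotomy (Arc⇒∈c xy) (Arc⇒∈c xy′)
    ... | inj₁ fy≡fy′      = ≤-reflexive (DistRoot-unique dist (subst (λ t → DistRoot tree t d′) (sym fy≡fy′) dist′))
    ... | inj₂ (inj₁ y≺y′) = <⇒≤ (Precedes⇒DistRoot< (c-IsBranch B (f x)) y≺y′ dist dist′)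
    ... | inj₂ (inj₂ y′≺y) = ⊥-elim (first y′ xy′ y′≺y)

  Last-precedes : ∀ {x y y′} → LastOutNeighbour x y → Arc x y′ → y′ ≢ y → Precedes (f y′) (f y) (c (f x))
  Last-precedes (xy , last) xy′ y′≢y with ∈-trichotomy (Arc⇒∈c xy′) (Arc⇒∈c xy)
  ... | inj₁ fy′≡fy      = ⊥-elim (y′≢y (f-injective fy′≡fy))
  ... | inj₂ (inj₁ y′≺y) = y′≺y
  ... | inj₂ (inj₂ y≺y′) = ⊥-elim (last _ xy′ y≺y′)

  Last-unique : ∀ {x y y′} → LastOutNeighbour x y → LastOutNeighbour x y′ → y′ ≡ y
  Last-unique {y = y} {y′} last-y@(xy , _) (xy′ , last-y′) with y′ ≟ y
  ... | yes y′≡y = y′≡y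
  ... | no y′≢y  = ⊥-elim (last-y′ y xy (Last-precedes last-y xy′ y′≢y))

module Subdivision (B : BurlingTree) (G : OGraph) (f : Fin (OGraph.n G) → Fin (BurlingTree.m B))
                   (derived : DerivedVia B G f) (u v : Fin (OGraph.n G)) (bottom : BottomArc B G f u v) where
  open BurlingTree B
  open OGraph G
  open Depth tree
  open Derived B G f derived

  U V a : Fin m
  U = f u
  V = f v
  a = par V

  v-last : LastOutNeighbour u v
  v-last = BottomArc⇒Last bottom

  V∈cU : V ∈ c U
  V∈cU = Arc⇒∈c (proj₁ bottom)

  cU≢[] : c U ≢ []
  cU≢[] cU≡[] with subst (V ∈_) cU≡[] V∈cU
  ... | ()

  U≢r : U ≢ r
  U≢r U≡r = cU≢[] (c-empty U (inj₁ U≡r))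

  U-not-last-born : ¬ IsLastBorn U
  U-not-last-born lb = cU≢[] (c-empty U (inj₂ lb))

  h : Fin m
  h = ℓ (par U)

  h-child : IsParentOf tree (par U) h
  h-child = ℓ-child (par U) U (U≢r , refl)

  cU-branch : IsBranchFrom tree h (c U)
  cU-branch = c-branch U U≢r U-not-last-born

  cU-starts-at-h : ∃[ rest ] c U ≡ h ∷ rest
  cU-starts-at-h with proj₂ cU-branch
  ... | inj₁ cU≡[] = ⊥-elim (cU≢[] cU≡[])
  ... | inj₂ starts = starts

  rest : List (Fin m)
  rest = proj₁ cU-starts-at-h

  cU≡h∷rest : c U ≡ h ∷ rest
  cU≡h∷rest = proj₂ cU-starts-at-h

  h∷rest-branch : IsBranch tree (h ∷ rest)
  h∷rest-branch = subst (IsBranch tree) cU≡h∷rest (proj₁ cU-branch)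

  V∈h∷rest : V ∈ h ∷ rest
  V∈h∷rest = subst (V ∈_) cU≡h∷rest V∈cU

  V≢r : V ≢ r
  V≢r = branch-∌-root h∷rest-branch (proj₁ h-child) V∈h∷rest

  V≢U : V ≢ U
  V≢U V≡U with subst (_∈ h ∷ rest) V≡U V∈h∷rest
  ... | here U≡h = U-not-last-born (U≢r , sym U≡h)
  ... | there U∈rest = Precedes⇒¬siblings h∷rest-branch (now U∈rest) (proj₁ h-child) U≢r (proj₂ h-child)

  ℓa-child : IsParentOf tree a (ℓ a)
  ℓa-child = ℓ-child a V (V≢r , refl)

  ℓa≢U : ℓ a ≢ U
  ℓa≢U ℓa≡U = U-not-last-born (U≢r , trans (cong ℓ parU≡a) ℓa≡U)
    where
    parU≡a : par U ≡ a
    parU≡a = trans (cong par (sym ℓa≡U)) (proj₂ ℓa-child)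

  parU≡a⇒ℓa≡V : par U ≡ a → ℓ a ≡ V
  parU≡a⇒ℓa≡V parU≡a with V∈h∷rest
  ... | here V≡h = trans (cong ℓ (sym parU≡a)) (sym V≡h)
  ... | there V∈rest = ⊥-elim (Precedes⇒¬siblings h∷rest-branch (now V∈rest) (proj₁ h-child) V≢r
                                                 (trans (proj₂ h-child) parU≡a))

  parU≢a⇒h≢V : par U ≢ a → h ≢ V
  parU≢a⇒h≢V parU≢a h≡V = parU≢a (trans (sym (proj₂ h-child)) (cong par h≡V))

  parU≢a⇒V∈rest : par U ≢ a → V ∈ rest
  parU≢a⇒V∈rest parU≢a with V∈h∷rest
  ... | here V≡h = ⊥-elim (parU≢a⇒h≢V parU≢a (sym V≡h))
  ... | there V∈rest = V∈rest

  m′ : ℕ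
  m′ = suc (suc m)

  pattern z = zero
  pattern w = suc zero
  pattern old t = suc (suc t)

  Moved : Fin m → Set
  Moved t = t ≢ r × par t ≡ a × t ≢ U

  -- Unfolded, does (moved? t) would reduce to a conjunction of three tests, which
  -- with moved? t could not abstract over.
  opaque
    moved? : ∀ t → Dec (Moved t)
    moved? t = ¬? (t ≟ r) ×-dec (par t ≟ a) ×-dec ¬? (t ≟ U)

  par′ : Fin m′ → Fin m′
  par′ z       = old a
  par′ w       = if does (par U ≟ a) then z else old a
  par′ (old t) = if does (moved? t) then z else old (par t)

  par′-moved : ∀ {t} → Moved t → par′ (old t) ≡ z
  par′-moved {t} moved rewrite dec-true (moved? t) moved = refl

  par′-unmoved : ∀ {t} → ¬ Moved t → par′ (old t) ≡ old (par t)
  par′-unmoved {t} unmoved rewrite dec-false (moved? t) unmoved = refl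

  par′-w≡z : par U ≡ a → par′ w ≡ z
  par′-w≡z parU≡a rewrite dec-true (par U ≟ a) parU≡a = refl

  par′-w≡a : par U ≢ a → par′ w ≡ old a
  par′-w≡a parU≢a rewrite dec-false (par U ≟ a) parU≢a = refl

  Reach′ : Fin m′ → Set
  Reach′ x = ∃[ k ] iter par′ k x ≡ old r

  Reach′-par′ : ∀ {x} → Reach′ (par′ x) → Reach′ x
  Reach′-par′ {x} (k , eq) = suc k , trans (iter-sucʳ par′ k x) eq

  Reach′-old-parent : ∀ t → Reach′ (old (par t)) → Reach′ (old t)
  Reach′-old-parent t reach-pt with moved? t
  ... | yes moved  = Reach′-par′ (subst Reach′ (sym (par′-moved moved))
                       (Reach′-par′ (subst (Reach′ ∘ old) (proj₁ (proj₂ moved)) reach-pt)))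
  ... | no unmoved = Reach′-par′ (subst Reach′ (sym (par′-unmoved unmoved)) reach-pt)

  reaches-root⇒Reach′-old : ∀ k t → iter par k t ≡ r → Reach′ (old t)
  reaches-root⇒Reach′-old zero    t refl = zero , refl
  reaches-root⇒Reach′-old (suc k) t eq =
    Reach′-old-parent t (reaches-root⇒Reach′-old k (par t) (trans (sym (iter-sucʳ par k t)) eq))

  reach′-old : ∀ t → Reach′ (old t)
  reach′-old t = let k , eq = reach t in reaches-root⇒Reach′-old k t eq

  reach′ : ∀ x → Reach′ x
  reach′ z       = Reach′-par′ (reach′-old a)
  reach′ w with par U ≟ a
  ... | yes parU≡a = Reach′-par′ (subst Reach′ (sym (par′-w≡z parU≡a)) (reach′ z))
  ... | no parU≢a  = Reach′-par′ (subst Reach′ (sym (par′-w≡a parU≢a)) (reach′-old a))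
  reach′ (old t) = reach′-old t

  r-unmoved : ¬ Moved r
  r-unmoved moved = proj₁ moved refl

  T′ : RootedTree
  T′ = record
    { m        = m′
    ; r        = old r
    ; par      = par′
    ; par-root = trans (par′-unmoved r-unmoved) (cong old par-root)
    ; reach    = reach′
    }

  module Depth′ = Depth T′

  ℓ′ : Fin m′ → Fin m′
  ℓ′ z       = old (ℓ a)
  ℓ′ w       = old r  -- w is a leaf, so this value is never constrained
  ℓ′ (old t) = if does (t ≟ a) then z else old (ℓ t)

  ℓ′-a : ℓ′ (old a) ≡ z
  ℓ′-a rewrite dec-true (a ≟ a) refl = refl

  ℓ′-old : ∀ {t} → t ≢ a → ℓ′ (old t) ≡ old (ℓ t)
  ℓ′-old {t} t≢a rewrite dec-false (t ≟ a) t≢a = refl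

  old-≢-root : ∀ {t} → t ≢ r → _≢_ {A = Fin m′} (old t) (old r)
  old-≢-root t≢r refl = t≢r refl

  w-childless : ∀ x → par′ x ≢ w
  w-childless z ()
  w-childless w = if-does-elim (_≢ w) (par U ≟ a) (λ _ ()) (λ _ ())
  w-childless (old t) = if-does-elim (_≢ w) (moved? t) (λ _ ()) (λ _ ())

  old-injective : ∀ {s t} → _≡_ {A = Fin m′} (old s) (old t) → s ≡ t
  old-injective refl = refl

  z≢old : ∀ {t} → _≢_ {A = Fin m′} z (old t)
  z≢old ()

  z-child : IsParentOf T′ (old a) z
  z-child = (λ ()) , refl

  moved-child : ∀ {y} → Moved y → IsParentOf T′ z (old y)
  moved-child moved = old-≢-root (proj₁ moved) , par′-moved moved

  unmoved-child : ∀ {t y} → ¬ Moved y → IsParentOf tree t y → IsParentOf T′ (old t) (old y)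
  unmoved-child unmoved (y≢r , refl) = old-≢-root y≢r , par′-unmoved unmoved

  child-of-unmoved : ∀ {t y} → t ≢ a → IsParentOf tree t y → IsParentOf T′ (old t) (old y)
  child-of-unmoved t≢a y-child =
    unmoved-child (λ moved → t≢a (trans (sym (proj₂ y-child)) (proj₁ (proj₂ moved)))) y-child

  old-child : ∀ {t x} → t ≢ a → IsParentOf T′ (old t) x → ∃[ y ] x ≡ old y × IsParentOf tree t y
  old-child {x = z} t≢a (_ , par′z≡t) = ⊥-elim (t≢a (sym (old-injective par′z≡t)))
  old-child {t} {w} t≢a (_ , par′w≡t) =
    ⊥-elim (if-does-elim (_≢ old t) (par U ≟ a) (λ _ ()) (λ _ a≡t → t≢a (sym (old-injective a≡t))) par′w≡t)
  old-child {x = old y} t≢a (y≢r , par′y≡t) with moved? y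
  ... | yes _ = ⊥-elim (z≢old par′y≡t)
  ... | no _  = y , refl , y≢r ∘ cong old , old-injective par′y≡t

  ℓ′-child : ∀ p x → IsParentOf T′ p x → IsParentOf T′ p (ℓ′ p)
  ℓ′-child z       _ _                  = moved-child (proj₁ ℓa-child , proj₂ ℓa-child , ℓa≢U)
  ℓ′-child w       x (_ , x-child)      = ⊥-elim (w-childless x x-child)
  ℓ′-child (old t) x x-child with t ≟ a
  ... | yes refl = z-child
  ... | no t≢a   = let y , _ , y-child = old-child t≢a x-child
                   in child-of-unmoved t≢a (ℓ-child t y y-child)

  liftBranchTail : List (Fin m) → List (Fin m′)
  liftBranchTail []       = []
  liftBranchTail (t ∷ ts) =
    if does (moved? t) then z ∷ old t ∷ liftBranchTail ts else old t ∷ liftBranchTail ts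

  liftBranch : List (Fin m) → List (Fin m′)
  liftBranch []       = []
  liftBranch (t ∷ ts) = old t ∷ liftBranchTail ts

  liftBranch-IsBranch : ∀ {x xs} → IsBranch tree (x ∷ xs) → IsBranch T′ (liftBranch (x ∷ xs))
  liftBranch-IsBranch (single x) = single (old x)
  liftBranch-IsBranch {x} (step {y = y} y-child br) with moved? y
  ... | yes moved  = step (subst (λ t → IsParentOf T′ (old t) z) a≡x z-child)
                          (step (moved-child moved) (liftBranch-IsBranch br))
    where
    a≡x : a ≡ x
    a≡x = trans (sym (proj₁ (proj₂ moved))) (proj₂ y-child)
  ... | no unmoved = step (unmoved-child unmoved y-child) (liftBranch-IsBranch br)

  liftBranch-IsBranchFrom : ∀ {x xs} → IsBranchFrom tree x xs → IsBranchFrom T′ (old x) (liftBranch xs)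
  liftBranch-IsBranchFrom (_  , inj₁ refl)        = empty , inj₁ refl
  liftBranch-IsBranchFrom (br , inj₂ (ys , refl)) = liftBranch-IsBranch br , inj₂ (liftBranchTail ys , refl)

  old∈liftBranchTail⇒∈ : ∀ {t} xs → old t ∈ liftBranchTail xs → t ∈ xs
  old∈liftBranchTail⇒∈ (y ∷ ys) t∈ with moved? y | t∈
  ... | yes _ | there (here refl) = here refl
  ... | yes _ | there (there t∈′) = there (old∈liftBranchTail⇒∈ ys t∈′)
  ... | no _  | here refl         = here refl
  ... | no _  | there t∈′         = there (old∈liftBranchTail⇒∈ ys t∈′)

  old∈liftBranch⇒∈ : ∀ {t} xs → old t ∈ liftBranch xs → t ∈ xs
  old∈liftBranch⇒∈ (y ∷ ys) (here refl) = here refl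
  old∈liftBranch⇒∈ (y ∷ ys) (there t∈)  = there (old∈liftBranchTail⇒∈ ys t∈)

  ∈⇒old∈liftBranchTail : ∀ {t} xs → t ∈ xs → old t ∈ liftBranchTail xs
  ∈⇒old∈liftBranchTail (y ∷ ys) t∈ with moved? y | t∈
  ... | yes _ | here refl = there (here refl)
  ... | yes _ | there t∈′ = there (there (∈⇒old∈liftBranchTail ys t∈′))
  ... | no _  | here refl = here refl
  ... | no _  | there t∈′ = there (∈⇒old∈liftBranchTail ys t∈′)

  ∈⇒old∈liftBranch : ∀ {t} xs → t ∈ xs → old t ∈ liftBranch xs
  ∈⇒old∈liftBranch (y ∷ ys) (here refl) = here refl
  ∈⇒old∈liftBranch (y ∷ ys) (there t∈)  = there (∈⇒old∈liftBranchTail ys t∈)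

  w∉liftBranchTail : ∀ xs → w ∉ liftBranchTail xs
  w∉liftBranchTail (y ∷ ys) w∈ with moved? y | w∈
  ... | yes _ | there (there w∈′) = w∉liftBranchTail ys w∈′
  ... | no _  | there w∈′         = w∉liftBranchTail ys w∈′

  w∉liftBranch : ∀ xs → w ∉ liftBranch xs
  w∉liftBranch (y ∷ ys) (there w∈) = w∉liftBranchTail ys w∈

  liftBranchTail-Precedes : ∀ {s t} xs → Precedes (old s) (old t) (liftBranchTail xs) → Precedes s t xs
  liftBranchTail-Precedes (y ∷ ys) s≺t with moved? y | s≺t
  ... | yes _ | later (now t∈)    = now (old∈liftBranchTail⇒∈ ys t∈)
  ... | yes _ | later (later s≺t′) = later (liftBranchTail-Precedes ys s≺t′)
  ... | no _  | now t∈            = now (old∈liftBranchTail⇒∈ ys t∈)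
  ... | no _  | later s≺t′        = later (liftBranchTail-Precedes ys s≺t′)

  liftBranch-Precedes : ∀ {s t} xs → Precedes (old s) (old t) (liftBranch xs) → Precedes s t xs
  liftBranch-Precedes (y ∷ ys) (now t∈)    = now (old∈liftBranchTail⇒∈ ys t∈)
  liftBranch-Precedes (y ∷ ys) (later s≺t) = later (liftBranchTail-Precedes ys s≺t)

  cutAtV : List (Fin m) → List (Fin m′)
  cutAtV []       = []
  cutAtV (t ∷ ts) = if does (t ≟ V) then w ∷ [] else old t ∷ cutAtV ts

  V∈⇒w∈cutAtV : ∀ xs → V ∈ xs → w ∈ cutAtV xs
  V∈⇒w∈cutAtV (t ∷ ts) V∈ with t ≟ V | V∈
  ... | yes _   | _          = here refl
  ... | no t≢V | here refl  = ⊥-elim (t≢V refl)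
  ... | no _   | there V∈′ = there (V∈⇒w∈cutAtV ts V∈′)

  Precedes-V⇒old∈cutAtV : ∀ {t} xs → IsBranch tree xs → Precedes t V xs → old t ∈ cutAtV xs
  Precedes-V⇒old∈cutAtV (y ∷ ys) br t≺V with y ≟ V | t≺V
  ... | yes refl | now _       = ⊥-elim (Precedes-irrefl br t≺V)
  ... | yes refl | later t≺V′  = ⊥-elim (Precedes-irrefl br (now (Precedes⇒∈ʳ t≺V′)))
  ... | no _     | now _       = here refl
  ... | no _     | later t≺V′  = there (Precedes-V⇒old∈cutAtV ys (IsBranch-tail br) t≺V′)

  old∈cutAtV⇒∈ : ∀ {t} xs → old t ∈ cutAtV xs → t ∈ xs × t ≢ V
  old∈cutAtV⇒∈ (y ∷ ys) t∈ with y ≟ V | t∈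
  ... | yes _  | there ()
  ... | no y≢V | here refl = here refl , y≢V
  ... | no _   | there t∈′ = let t∈ys , t≢V = old∈cutAtV⇒∈ ys t∈′ in there t∈ys , t≢V

  cutAtV-Precedes : ∀ {s t} xs → Precedes (old s) (old t) (cutAtV xs) → Precedes s t xs
  cutAtV-Precedes (y ∷ ys) s≺t with y ≟ V | s≺t
  ... | yes _ | later ()
  ... | no _ | now t∈     = now (proj₁ (old∈cutAtV⇒∈ ys t∈))
  ... | no _ | later s≺t′ = later (cutAtV-Precedes ys s≺t′)

  w-last-in-cutAtV : ∀ {x} xs → ¬ Precedes w x (cutAtV xs)
  w-last-in-cutAtV (y ∷ ys) w≺x with y ≟ V | w≺x
  ... | yes _ | later ()
  ... | no _ | later w≺x′ = w-last-in-cutAtV ys w≺x′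

  cutAtV-IsBranch : ∀ {t ts} → par U ≢ a → IsBranch tree (t ∷ ts) → V ∈ ts
                  → IsBranch T′ (old t ∷ cutAtV ts)
  cutAtV-IsBranch {t} {y ∷ ys} parU≢a (step y-child br) V∈ with y ≟ V | V∈
  ... | yes refl | _         = step ((λ ()) , trans (par′-w≡a parU≢a) (cong old (proj₂ y-child))) (single w)
  ... | no y≢V   | here refl = ⊥-elim (y≢V refl)
  ... | no y≢V   | there V∈ys = step (unmoved-child unmoved y-child) (cutAtV-IsBranch parU≢a br V∈ys)
    where
    unmoved : ¬ Moved y
    unmoved (y≢r , pary≡a , _) = Precedes⇒¬siblings br (now V∈ys) y≢r V≢r pary≡a

  cU′ : List (Fin m′)
  cU′ = if does (par U ≟ a) then z ∷ cutAtV (c U) else cutAtV (c U)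

  c′ : Fin m′ → List (Fin m′)
  c′ z       = []
  c′ w       = if does (par U ≟ a) then old V ∷ [] else z ∷ old V ∷ []
  c′ (old t) = if does (t ≟ U) then cU′ else liftBranch (c t)

  U-unmoved : ¬ Moved U
  U-unmoved (_ , _ , U≢U) = U≢U refl

  ℓ′∘par′-old : ∀ {t} → t ≢ r → t ≢ U → ℓ′ (par′ (old t)) ≡ old (ℓ (par t))
  ℓ′∘par′-old {t} t≢r t≢U with moved? t
  ... | yes (_ , part≡a , _) = cong (old ∘ ℓ) (sym part≡a)
  ... | no unmoved           = ℓ′-old (λ part≡a → unmoved (t≢r , part≡a , t≢U))

  cU′-IsBranchFrom : IsBranchFrom T′ (ℓ′ (par′ (old U))) cU′
  cU′-IsBranchFrom rewrite par′-unmoved U-unmoved | cU≡h∷rest with par U ≟ a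
  ... | yes parU≡a rewrite dec-true (h ≟ V) (trans (cong ℓ parU≡a) (parU≡a⇒ℓa≡V parU≡a)) =
    step ((λ ()) , par′-w≡z parU≡a) (single w) , inj₂ (w ∷ [] , refl)
  ... | no parU≢a rewrite dec-false (h ≟ V) (parU≢a⇒h≢V parU≢a) =
    cutAtV-IsBranch parU≢a h∷rest-branch (parU≢a⇒V∈rest parU≢a) , inj₂ (cutAtV rest , refl)

  cw′-IsBranchFrom : IsBranchFrom T′ (ℓ′ (par′ w)) (c′ w)
  cw′-IsBranchFrom with par U ≟ a
  ... | yes parU≡a = single (old V) , inj₂ ([] , cong (λ t → old t ∷ []) (sym (parU≡a⇒ℓa≡V parU≡a)))
  ... | no _ rewrite ℓ′-a = step (moved-child (V≢r , refl , V≢U)) (single (old V)) , inj₂ (old V ∷ [] , refl)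

  c-branch′ : ∀ x → x ≢ old r → ¬ (x ≢ old r × ℓ′ (par′ x) ≡ x)
            → IsBranchFrom T′ (ℓ′ (par′ x)) (c′ x)
  c-branch′ z _ _ = empty , inj₁ refl
  c-branch′ w _ _ = cw′-IsBranchFrom
  c-branch′ (old t) t≢r _ with t ≟ U
  ... | yes refl = cU′-IsBranchFrom
  ... | no t≢U with ℓ (par t) ≟ t
  ...   | yes last-born rewrite c-empty t (inj₂ ((t≢r ∘ cong old) , last-born)) = empty , inj₁ refl
  ...   | no ¬last-born rewrite ℓ′∘par′-old (t≢r ∘ cong old) t≢U =
    liftBranch-IsBranchFrom (c-branch t (t≢r ∘ cong old) (¬last-born ∘ proj₂))

  ℓ′≢w : ∀ x → ℓ′ x ≢ w
  ℓ′≢w z ()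
  ℓ′≢w w ()
  ℓ′≢w (old t) = if-does-elim (_≢ w) (t ≟ a) (λ _ ()) (λ _ ())

  U-not-last-born′ : ℓ′ (par′ (old U)) ≢ old U
  U-not-last-born′ rewrite par′-unmoved U-unmoved with par U ≟ a
  ... | yes _ = λ ()
  ... | no _  = λ ℓparU≡U → U-not-last-born (U≢r , old-injective ℓparU≡U)

  c-empty′ : ∀ x → (x ≡ old r ⊎ (x ≢ old r × ℓ′ (par′ x) ≡ x)) → c′ x ≡ []
  c-empty′ z _ = refl
  c-empty′ w (inj₂ (_ , last-born)) = ⊥-elim (ℓ′≢w (par′ w) last-born)
  c-empty′ (old t) empty-cases with t ≟ U | empty-cases
  ... | yes refl | inj₁ U≡r = ⊥-elim (U≢r (old-injective U≡r))
  ... | yes refl | inj₂ (_ , last-born) = ⊥-elim (U-not-last-born′ last-born)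
  ... | no _     | inj₁ t≡r = cong liftBranch (c-empty t (inj₁ (old-injective t≡r)))
  ... | no t≢U   | inj₂ (t≢r , last-born) =
    cong liftBranch (c-empty t (inj₂ (t≢r ∘ cong old ,
      old-injective (trans (sym (ℓ′∘par′-old (t≢r ∘ cong old) t≢U)) last-born))))

  B′ : BurlingTree
  B′ = record
    { tree     = T′
    ; ℓ        = ℓ′
    ; ℓ-child  = ℓ′-child
    ; c        = c′
    ; c-branch = c-branch′
    ; c-empty  = c-empty′
    }

  G′ : OGraph
  G′ = subdivide G u v

  f′ : Fin (suc n) → Fin m′
  f′ zero    = w
  f′ (suc x) = old (f x)

  f′-injective : ∀ {x y} → f′ x ≡ f′ y → x ≡ y
  f′-injective {zero}  {zero}  _  = refl
  f′-injective {suc _} {suc _} eq = cong suc (f-injective (old-injective eq))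

  w∈cU′ : w ∈ cU′
  w∈cU′ with par U ≟ a
  ... | yes _ = there (V∈⇒w∈cutAtV (c U) V∈cU)
  ... | no _  = V∈⇒w∈cutAtV (c U) V∈cU

  old∈cU′⇒old∈cutAtV : ∀ {t} → old t ∈ cU′ → old t ∈ cutAtV (c U)
  old∈cU′⇒old∈cutAtV t∈ with par U ≟ a | t∈
  ... | yes _ | there t∈′ = t∈′
  ... | no _  | t∈′       = t∈′

  old∈cutAtV⇒old∈cU′ : ∀ {t} → old t ∈ cutAtV (c U) → old t ∈ cU′
  old∈cutAtV⇒old∈cU′ t∈ with par U ≟ a
  ... | yes _ = there t∈
  ... | no _  = t∈

  Arc′ : Fin (suc n) → Fin (suc n) → Set
  Arc′ = OGraph.Arc G′

  Arc′-from-w : ∀ y → (Arc′ zero y → f′ y ∈ c′ w) × (f′ y ∈ c′ w → Arc′ zero y)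
  Arc′-from-w zero    = (λ ()) , w∉c′w
    where
    w∉c′w : w ∉ c′ w
    w∉c′w w∈ with par U ≟ a | w∈
    ... | yes _ | here ()
    ... | no _  | there (here ())
  Arc′-from-w (suc y) = (λ { refl → V∈c′w }) , λ fy∈ → f-injective (only-V-in-c′w fy∈)
    where
    V∈c′w : old V ∈ c′ w
    V∈c′w with par U ≟ a
    ... | yes _ = here refl
    ... | no _  = there (here refl)
    only-V-in-c′w : old (f y) ∈ c′ w → f y ≡ V
    only-V-in-c′w fy∈ with par U ≟ a | fy∈
    ... | yes _ | here fy≡V         = old-injective fy≡V
    ... | no _  | there (here fy≡V) = old-injective fy≡V

  Arc′-from-old : ∀ x y → (Arc′ (suc x) y → f′ y ∈ c′ (old (f x)))
                        × (f′ y ∈ c′ (old (f x)) → Arc′ (suc x) y)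
  Arc′-from-old x y with f x ≟ U | y
  ... | yes fx≡U | zero   = (λ _ → w∈cU′) , (λ _ → f-injective fx≡U)
  ... | no fx≢U  | zero   = (λ x≡u → ⊥-elim (fx≢U (cong f x≡u))) , (λ w∈ → ⊥-elim (w∉liftBranch (c (f x)) w∈))
  ... | yes fx≡U | suc y′ = to , from
    where
    x≡u : x ≡ u
    x≡u = f-injective fx≡U
    to : Arc x y′ × ¬ (x ≡ u × y′ ≡ v) → old (f y′) ∈ cU′
    to (xy′ , not-uv) = old∈cutAtV⇒old∈cU′ (Precedes-V⇒old∈cutAtV (c U) (c-IsBranch B U)
                          (Last-precedes v-last (subst (λ s → Arc s y′) x≡u xy′) (λ y′≡v → not-uv (x≡u , y′≡v))))
    from : old (f y′) ∈ cU′ → Arc x y′ × ¬ (x ≡ u × y′ ≡ v)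
    from fy′∈ = let fy′∈cU , fy′≢V = old∈cutAtV⇒∈ (c U) (old∈cU′⇒old∈cutAtV fy′∈)
                in ∈c⇒Arc (subst (λ s → f y′ ∈ c s) (sym fx≡U) fy′∈cU) , λ (_ , y′≡v) → fy′≢V (cong f y′≡v)
  ... | no fx≢U  | suc y′ =
    (λ (xy′ , _) → ∈⇒old∈liftBranch (c (f x)) (Arc⇒∈c xy′)) ,
    (λ fy′∈ → ∈c⇒Arc (old∈liftBranch⇒∈ (c (f x)) fy′∈) , λ (x≡u , _) → fx≢U (cong f x≡u))

  derived′ : DerivedVia B′ G′ f′
  derived′ = f′-injective , λ where
    zero    y → Arc′-from-w y
    (suc x) y → Arc′-from-old x y

  module Derived′ = Derived B′ G′ f′ derived′

  w-last-in-c′ : ∀ t {x} → ¬ Precedes w x (c′ (old t))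
  w-last-in-c′ t w≺x with t ≟ U | par U ≟ a | w≺x
  ... | yes _ | yes _ | later w≺x′ = w-last-in-cutAtV (c U) w≺x′
  ... | yes _ | no _  | w≺x′       = w-last-in-cutAtV (c U) w≺x′
  ... | no _  | _     | w≺x′       = w∉liftBranch (c t) (Precedes⇒∈ˡ w≺x′)

  c′-Precedes : ∀ t {s s′} → Precedes (old s) (old s′) (c′ (old t)) → Precedes s s′ (c t)
  c′-Precedes t s≺s′ with t ≟ U | par U ≟ a | s≺s′
  ... | yes refl | yes _ | later s≺s′′ = cutAtV-Precedes (c U) s≺s′′
  ... | yes refl | no _  | s≺s′′       = cutAtV-Precedes (c U) s≺s′′
  ... | no _     | _     | s≺s′′       = liftBranch-Precedes (c t) s≺s′′

  uw-bottom : BottomArc B′ G′ f′ (suc u) zero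
  uw-bottom = Derived′.Last⇒BottomArc {suc u} {zero} (refl , λ _ _ → w-last-in-c′ U)

  wv-bottom : BottomArc B′ G′ f′ zero (suc v)
  wv-bottom = Derived′.Last⇒BottomArc {zero} {suc v}
    (refl , λ { (suc _) refl → Depth′.Precedes-irrefl (c-IsBranch B′ w) })

  wv-top : TopArc B′ G′ f′ zero (suc v)
  wv-top = Derived′.First⇒TopArc {zero} {suc v}
    (refl , λ { (suc _) refl → Depth′.Precedes-irrefl (c-IsBranch B′ w) })

  TopArc-preserved : ∀ x y → TopArc B G f x y → ¬ (x ≡ u × y ≡ v)
                   → TopArc B′ G′ f′ (suc x) (suc y)
  TopArc-preserved x y top not-uv = Derived′.First⇒TopArc ((proj₁ top , not-uv) , first′)
    where
    first′ : ∀ y′ → Arc′ (suc x) y′ → ¬ Precedes (f′ y′) (old (f y)) (c′ (old (f x)))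
    first′ zero     _          = w-last-in-c′ (f x)
    first′ (suc y′) (xy′ , _)  = proj₂ (TopArc⇒First top) y′ xy′ ∘ c′-Precedes (f x)

  BottomArc-preserved : ∀ x y → BottomArc B G f x y → ¬ (x ≡ u × y ≡ v)
                      → BottomArc B′ G′ f′ (suc x) (suc y)
  BottomArc-preserved x y bot not-uv = Derived′.Last⇒BottomArc ((proj₁ bot , not-uv) , last′)
    where
    last′ : ∀ y′ → Arc′ (suc x) y′ → ¬ Precedes (old (f y)) (f′ y′) (c′ (old (f x)))
    last′ zero     refl      _ = not-uv (refl , Last-unique v-last (BottomArc⇒Last bot))
    last′ (suc y′) (xy′ , _)   = proj₂ (BottomArc⇒Last bot) y′ xy′ ∘ c′-Precedes (f x)

lemma3p6 : (B : BurlingTree) (G : OGraph) (f : Fin (OGraph.n G) → Fin (BurlingTree.m B))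
    → DerivedVia B G f
    → (u v : Fin (OGraph.n G)) → BottomArc B G f u v
    → Σ[ B' ∈ BurlingTree ] Σ[ f' ∈ (Fin (OGraph.n (subdivide G u v)) → Fin (BurlingTree.m B')) ]
    ( DerivedVia B' (subdivide G u v) f'
    × BottomArc B' (subdivide G u v) f' (suc u) zero
    × BottomArc B' (subdivide G u v) f' zero (suc v)
    × TopArc B' (subdivide G u v) f' zero (suc v)
    × (∀ x y → TopArc B G f x y → ¬ (x ≡ u × y ≡ v) → TopArc B' (subdivide G u v) f' (suc x) (suc y))
    × (∀ x y → BottomArc B G f x y → ¬ (x ≡ u × y ≡ v) → BottomArc B' (subdivide G u v) f' (suc x) (suc y)))
lemma3p6 B G f derived u v bottom =
  B′ , f′ , derived′ , uw-bottom , wv-bottom , wv-top , TopArc-preserved , BottomArc-preserved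
  where open Subdivision B G f derived u v bottom
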